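{- Let $H$ be a cubic graph (loopless, parallel edges allowed) that has a perfect matching, and let $H_{\Delta}$ be the cubic graph obtained from $H$ by replacing every vertex of $H$ by a triangle. Then $\chi'_{N}(H_{\Delta})\leq 6$.
   Context: Graphs are finite, undirected, without loops, possibly with parallel edges. Replacing a vertex $v$ of a cubic graph by a triangle means deleting $v$, adding three new vertices forming a triangle, and attaching each of the three edges formerly incident with $v$ to a distinct one of the new vertices. A $k$-edge-coloring is a proper edge-coloring with colors from $\{1,\dots,k\}$ (adjacent edges receive different colors). For an edge-coloring $c$ and a vertex $v$, let $S_c(v)$ be the set of colors on the edges incident with $v$. An edge $uv$ of a cubic graph is poor if $|S_c(u)\cup S_c(v)|=3$, rich if $|S_c(u)\cup S_c(v)|=5$, and normal if it is poor or rich. An edge-coloring is normal if every edge is normal. $\chi'_N(G)$ denotes the smallest $k$ such that $G$ admits a normal $k$-edge-coloring. -}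

module Defs where

open import Data.Nat using (ℕ; zero; suc; _+_; _*_; _≤_)
open import Data.Fin using (Fin; zero; suc; combine; _≟_)
open import Data.Fin.Properties using (any?)
open import Data.Fin.Subset using (Subset; _∪_; ∣_∣)
open import Data.List using (List; []; _∷_; _++_; length; lookup; map; concatMap; allFin)
open import Data.Vec using (tabulate)
open import Data.Product using (Σ; Σ-syntax; ∃; _×_; _,_; proj₁; proj₂)
open import Data.Product.Properties using () 
open import Data.Sum using (_⊎_)
open import Data.Bool using (Bool; true; false; if_then_else_)
open import Relation.Nullary using (¬_; Dec; yes; no)
open import Relation.Nullary.Decidable using (⌊_⌋; _⊎-dec_; _×-dec_)
open import Relation.Binary.PropositionalEquality using (_≡_; _≢_)

-- A finite multigraph: vertices Fin n, edges given as a list of endpoint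
-- pairs (parallel edges = repeated pairs); edge identities are list positions.
record Multigraph : Set where
  constructor mkGraph
  field
    n     : ℕ
    edges : List (Fin n × Fin n)

open Multigraph public

Vertex : Multigraph → Set
Vertex G = Fin (n G)

Edge : Multigraph → Set
Edge G = Fin (length (edges G))

end₁ end₂ : (G : Multigraph) → Edge G → Vertex G
end₁ G e = proj₁ (lookup (edges G) e)
end₂ G e = proj₂ (lookup (edges G) e)

Incident : (G : Multigraph) → Edge G → Vertex G → Set
Incident G e v = (end₁ G e ≡ v) ⊎ (end₂ G e ≡ v)

incident? : (G : Multigraph) (e : Edge G) (v : Vertex G) → Dec (Incident G e v)
incident? G e v = (end₁ G e ≟ v) ⊎-dec (end₂ G e ≟ v)

Loopless : Multigraph → Set
Loopless G = (e : Edge G) → end₁ G e ≢ end₂ G e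

δ : (b : Bool) → ℕ
δ true = 1
δ false = 0

sumFin : {m : ℕ} → (Fin m → ℕ) → ℕ
sumFin {zero} f = 0
sumFin {suc m} f = f zero + sumFin (λ i → f (suc i))

degree : (G : Multigraph) → Vertex G → ℕ
degree G v = sumFin (λ (e : Edge G) → δ ⌊ end₁ G e ≟ v ⌋ + δ ⌊ end₂ G e ≟ v ⌋)

Cubic : Multigraph → Set
Cubic G = Loopless G × ((v : Vertex G) → degree G v ≡ 3)

PerfectMatching : (G : Multigraph) → (Edge G → Bool) → Set
PerfectMatching G M = (v : Vertex G) →
  Σ[ e ∈ Edge G ] (M e ≡ true × Incident G e v ×
    ((e' : Edge G) → M e' ≡ true → Incident G e' v → e' ≡ e))

HasPerfectMatching : Multigraph → Set
HasPerfectMatching G = Σ[ M ∈ (Edge G → Bool) ] PerfectMatching G M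

pairs : {A : Set} → List A → List (A × A)
pairs [] = []
pairs (x ∷ xs) = map (λ y → (x , y)) xs ++ pairs xs

-- The new vertices are the half-edges
-- (e , s) of G (s = 0 : first end, s = 1 : second end), encoded as Fin (m * 2).
-- Edges: each original edge e joins (e,0) and (e,1); for each vertex v of G,
-- all pairs of half-edges at v are joined (for cubic G: a triangle).
module _ (G : Multigraph) where
  private
    m = length (edges G)

    endAt : Edge G → Fin 2 → Vertex G
    endAt e zero = end₁ G e
    endAt e (suc _) = end₂ G e

    halfEdgesAt : Vertex G → List (Fin (m * 2))
    halfEdgesAt v = concatMap (λ e → concatMap
      (λ s → if ⌊ endAt e s ≟ v ⌋ then combine e s ∷ [] else [])
      (allFin 2)) (allFin m)

  triangleReplace : Multigraph
  triangleReplace = mkGraph (m * 2)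
    (map (λ e → (combine e zero , combine e (suc zero))) (allFin m)
     ++ concatMap (λ v → pairs (halfEdgesAt v)) (allFin (n G)))

EdgeColoring : Multigraph → ℕ → Set
EdgeColoring G k = Edge G → Fin k

Proper : (G : Multigraph) {k : ℕ} → EdgeColoring G k → Set
Proper G c = (e e' : Edge G) → e ≢ e' →
  Σ[ v ∈ Vertex G ] (Incident G e v × Incident G e' v) → c e ≢ c e'

S : (G : Multigraph) {k : ℕ} → EdgeColoring G k → Vertex G → Subset k
S G c v = tabulate (λ col → ⌊ any? (λ e → incident? G e v ×-dec (c e ≟ col)) ⌋)

Poor Rich NormalEdge : (G : Multigraph) {k : ℕ} → EdgeColoring G k → Edge G → Set
Poor G c e = ∣ S G c (end₁ G e) ∪ S G c (end₂ G e) ∣ ≡ 3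
Rich G c e = ∣ S G c (end₁ G e) ∪ S G c (end₂ G e) ∣ ≡ 5
NormalEdge G c e = Poor G c e ⊎ Rich G c e

NormalColoring : (G : Multigraph) {k : ℕ} → EdgeColoring G k → Set
NormalColoring G c = Proper G c × ((e : Edge G) → NormalEdge G c e)

χ'N≤ : Multigraph → ℕ → Set
χ'N≤ G k = Σ[ j ∈ ℕ ] (j ≤ k × Σ[ c ∈ EdgeColoring G j ] NormalColoring G c)

-- Let F = H − M be the 2-factor complementary to the perfect matching M. Colour the edges of F
-- greedily with Fin 3 so that the two F-edges at each vertex get different colours a ≢ b, and let r
-- be the third. In H_Δ, matching edges get colour 0, an F-edge of colour c gets 1 + c, the side of
-- the triangle of v joining its two F-corners gets 1 + r, and the two sides at the matched corner get
-- the spare colours 4 and 5, distinguished by cyclic orientation. Then the six edges meeting a triangle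
-- carry six different colours, so the colouring is proper and every triangle side is rich. A matching
-- edge sees {0, 4, 5} at both ends, so it is poor. An F-edge of colour c sees 1 + c, 1 + r and a spare
-- colour fixed by the orientation of (c, r) at an end whose vertex misses r; so its two ends see the
-- same set when they miss the same colour, and otherwise they miss r ≢ r′ and see different spares.

module Submission where

open import Data.Nat using (ℕ; zero; suc; _+_; _*_; _<_; s≤s⁻¹)
import Data.Nat as ℕ
open import Data.Nat.Properties using (≤∧≢⇒<; ≤-refl)
open import Data.Fin using (Fin; zero; suc; toℕ; combine; remQuot; _≟_; #_)
open import Data.Fin.Properties
  using (any?; all?; toℕ-injective; toℕ<n; remQuot-combine; combine-remQuot; combine-injective)
open import Data.Fin.Permutation using (transpose; _⟨$⟩ʳ_; _⟨$⟩ˡ_; inverseʳ; inverseˡ)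
open import Data.Fin.Subset using (Subset; _∪_; ∣_∣; ⁅_⁆)
open import Data.Vec using (tabulate)
open import Data.Vec.Properties using (≡-dec; tabulate-cong)
import Data.Bool.Properties as Bool
open import Data.Bool using (Bool; true; false; if_then_else_)
open import Data.List using (List; []; _∷_; length; map; concatMap; allFin; lookup)
import Data.List as List
open import Data.List.Properties using (length-++)
open import Data.List.Membership.Propositional using (_∈_; _∉_)
open import Data.List.Membership.Propositional.Properties
  using (∈-map⁺; ∈-map⁻; ∈-++⁺ˡ; ∈-++⁺ʳ; ∈-++⁻; ∈-concatMap⁺; ∈-concatMap⁻; ∈-allFin; ∈-lookup)
open import Data.List.Relation.Unary.All as All using ([]; _∷_)
import Data.List.Relation.Unary.All.Properties as All
open import Data.List.Relation.Unary.Any as Any using (here; there; satisfied)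
open import Data.List.Relation.Unary.Any.Properties using (tabulate⁺; lookup-index)
import Data.List.Relation.Unary.AllPairs as AllPairs
import Data.List.Relation.Unary.AllPairs.Properties as AllPairs
open import Data.List.Relation.Unary.Unique.Propositional using (Unique; []; _∷_)
import Data.List.Relation.Unary.Unique.Propositional.Properties as Unique
open import Data.List.Relation.Binary.Disjoint.Propositional using (Disjoint)
open import Data.Product using (Σ; ∃; ∃₂; _×_; _,_; proj₁; proj₂)
open import Data.Product.Properties using (,-injectiveˡ; ,-injectiveʳ)
open import Data.Sum using (_⊎_; inj₁; inj₂)
open import Data.Empty using (⊥-elim)
open import Function using (_∘_; case_of_)
open import Function.Bundles using (mk⇔)
open import Relation.Nullary using (¬_; Dec; does; yes; no)
open import Relation.Nullary.Decidable
  using (⌊_⌋; toWitness; _⊎-dec_; _×-dec_; _→-dec_; ¬?; dec-true; dec-false; isYes≗does; does-⇔)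
open import Relation.Binary.PropositionalEquality
  using (_≡_; _≢_; refl; sym; trans; cong; cong₂; subst; subst₂)
open import Defs

F3 : Set
F3 = Fin 3

pattern 0F = zero
pattern 1F = suc zero
pattern 2F = suc (suc zero)

-- For a ≢ b, third a b is the remaining element of Fin 3; third a a = a is junk.
third : F3 → F3 → F3
third 0F 1F = 2F
third 0F 2F = 1F
third 1F 0F = 2F
third 1F 2F = 0F
third 2F 0F = 1F
third 2F 1F = 0F
third a _ = a

avoid : F3 → F3 → F3
avoid 0F 0F = 1F
avoid 1F 1F = 2F
avoid 2F 2F = 0F
avoid a b = third a b

third-comm : ∀ a b → third a b ≡ third b a
third-comm = toWitness {a? = all? λ a → all? λ b → third a b ≟ third b a} _

avoid-≢ˡ : ∀ a b → avoid a b ≢ a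
avoid-≢ˡ = toWitness {a? = all? λ a → all? λ b → ¬? (avoid a b ≟ a)} _

avoid-≢ʳ : ∀ a b → avoid a b ≢ b
avoid-≢ʳ = toWitness {a? = all? λ a → all? λ b → ¬? (avoid a b ≟ b)} _

isYes-⇔ : ∀ {A B : Set} → (A → B) → (B → A) → (a? : Dec A) (b? : Dec B) → ⌊ a? ⌋ ≡ ⌊ b? ⌋
isYes-⇔ f g a? b? = trans (isYes≗does a?) (trans (does-⇔ (mk⇔ f g) a? b?) (sym (isYes≗does b?)))

-- Greedy colouring

module GreedyColouring {m : ℕ} (nb : Fin m → Fin 2 → Fin m) where

  colourBefore : ℕ → Fin m → F3
  colourBefore zero x = 0F
  colourBefore (suc k) x =
    if does (toℕ x ℕ.≟ k)
    then avoid (colourBefore k (nb x 0F)) (colourBefore k (nb x 1F))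
    else colourBefore k x

  colour : Fin m → F3
  colour = colourBefore m

  private
    colourBefore-at : ∀ k x → toℕ x ≡ k →
      colourBefore (suc k) x ≡ avoid (colourBefore k (nb x 0F)) (colourBefore k (nb x 1F))
    colourBefore-at k x eq rewrite dec-true (toℕ x ℕ.≟ k) eq = refl

    colourBefore-other : ∀ k x → toℕ x ≢ k → colourBefore (suc k) x ≡ colourBefore k x
    colourBefore-other k x ne rewrite dec-false (toℕ x ℕ.≟ k) ne = refl

    avoids-neighbours : ∀ k x s → toℕ x ≡ k → colourBefore (suc k) x ≢ colourBefore k (nb x s)
    avoids-neighbours k x 0F x≡k rewrite colourBefore-at k x x≡k =
      avoid-≢ˡ (colourBefore k (nb x 0F)) (colourBefore k (nb x 1F))
    avoids-neighbours k x 1F x≡k rewrite colourBefore-at k x x≡k =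
      avoid-≢ʳ (colourBefore k (nb x 0F)) (colourBefore k (nb x 1F))

    proper-before : ∀ k x s s′ → nb x s ≢ x → nb (nb x s) s′ ≡ x →
                    toℕ x < k → toℕ (nb x s) < k → colourBefore k x ≢ colourBefore k (nb x s)
    proper-before zero _ _ _ _ _ () _
    proper-before (suc k) x s s′ nb≢x back x<k y<k with toℕ x ℕ.≟ k | toℕ (nb x s) ℕ.≟ k
    ... | yes x≡k | yes y≡k = λ _ → nb≢x (toℕ-injective (trans y≡k (sym x≡k)))
    ... | yes x≡k | no y≢k = λ eq →
      avoids-neighbours k x s x≡k (trans eq (colourBefore-other k _ y≢k))
    ... | no x≢k | yes y≡k = λ eq →
      avoids-neighbours k (nb x s) s′ y≡k
        (trans (sym eq) (trans (colourBefore-other k x x≢k) (cong (colourBefore k) (sym back))))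
    ... | no x≢k | no y≢k = λ eq →
      proper-before k x s s′ nb≢x back (≤∧≢⇒< (s≤s⁻¹ x<k) x≢k) (≤∧≢⇒< (s≤s⁻¹ y<k) y≢k)
        (trans (sym (colourBefore-other k x x≢k)) (trans eq (colourBefore-other k _ y≢k)))

  -- Whichever of x and y = nb x s is coloured later avoids the other, since each lists the other as a neighbour.
  colour-proper : ∀ x s s′ → nb x s ≢ x → nb (nb x s) s′ ≡ x → colour x ≢ colour (nb x s)
  colour-proper x s s′ nb≢x back = proper-before m x s s′ nb≢x back (toℕ<n x) (toℕ<n (nb x s))

-- The colour scheme around one triangle

-- At a vertex of H, corner 0F of its triangle is the half-edge on the matching edge and corners 1F, 2F
-- lie on 2-factor edges whose 2-factor colours a ≢ b are painted factorColour a and factorColour b.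
-- sideColour a b q colours the triangle side opposite corner q, and aroundColour a b p j is the colour
-- at corner p of its edge towards corner j (its pendant edge when j = p).

matchColour : Fin 6
matchColour = # 0

factorColour : F3 → Fin 6
factorColour 0F = # 1
factorColour 1F = # 2
factorColour 2F = # 3

spareColour : F3 → F3 → Fin 6
spareColour 0F 1F = # 4
spareColour 1F 2F = # 4
spareColour 2F 0F = # 4
spareColour _ _ = # 5

cornerColour : F3 → F3 → F3 → F3
cornerColour a b 2F = b
cornerColour a b _ = a

pendantColour : F3 → F3 → F3 → Fin 6
pendantColour a b 0F = matchColour
pendantColour a b p = factorColour (cornerColour a b p)

sideColour : F3 → F3 → F3 → Fin 6
sideColour a b 0F = factorColour (third a b)
sideColour a b 1F = spareColour a (third a b)
sideColour a b 2F = spareColour b (third a b)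

aroundColour : F3 → F3 → F3 → F3 → Fin 6
aroundColour a b p j = if does (j ≟ p) then pendantColour a b p else sideColour a b (third p j)

aroundSet : F3 → F3 → F3 → Subset 6
aroundSet a b p = tabulate (λ k → ⌊ any? (λ j → aroundColour a b p j ≟ k) ⌋)

colourSet : Fin 6 → Fin 6 → Fin 6 → Subset 6
colourSet x y z = ⁅ x ⁆ ∪ ⁅ y ⁆ ∪ ⁅ z ⁆

factorSet : F3 → F3 → Subset 6
factorSet c r = colourSet (factorColour c) (factorColour r) (spareColour (third c r) r)

NormalPair : Subset 6 → Subset 6 → Set
NormalPair A B = ∣ A ∪ B ∣ ≡ 3 ⊎ ∣ A ∪ B ∣ ≡ 5

private
  _≟ˢ_ : (A B : Subset 6) → Dec (A ≡ B)
  _≟ˢ_ = ≡-dec Bool._≟_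

  normalPair? : ∀ A B → Dec (NormalPair A B)
  normalPair? A B = (∣ A ∪ B ∣ ℕ.≟ 3) ⊎-dec (∣ A ∪ B ∣ ℕ.≟ 5)

aroundColour-injective : ∀ a b → a ≢ b → ∀ p j j′ → aroundColour a b p j ≡ aroundColour a b p j′ → j ≡ j′
aroundColour-injective = toWitness {a? = all? λ a → all? λ b → ¬? (a ≟ b) →-dec all? λ p → all? λ j → all? λ j′ →
  (aroundColour a b p j ≟ aroundColour a b p j′) →-dec (j ≟ j′)} _

aroundSet-side : ∀ a b → a ≢ b → ∀ p q → p ≢ q → ∣ aroundSet a b p ∪ aroundSet a b q ∣ ≡ 5
aroundSet-side = toWitness {a? = all? λ a → all? λ b → ¬? (a ≟ b) →-dec all? λ p → all? λ q → ¬? (p ≟ q) →-dec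
  (∣ aroundSet a b p ∪ aroundSet a b q ∣ ℕ.≟ 5)} _

aroundSet-matched : ∀ a b → a ≢ b → aroundSet a b 0F ≡ colourSet matchColour (# 4) (# 5)
aroundSet-matched = toWitness {a? = all? λ a → all? λ b → ¬? (a ≟ b) →-dec
  (aroundSet a b 0F ≟ˢ colourSet matchColour (# 4) (# 5))} _

aroundSet-factor : ∀ a b → a ≢ b → ∀ p → p ≢ 0F → aroundSet a b p ≡ factorSet (cornerColour a b p) (third a b)
aroundSet-factor = toWitness {a? = all? λ a → all? λ b → ¬? (a ≟ b) →-dec all? λ p → ¬? (p ≟ 0F) →-dec
  (aroundSet a b p ≟ˢ factorSet (cornerColour a b p) (third a b))} _

third-≢-cornerColour : ∀ a b → a ≢ b → ∀ p → p ≢ 0F → third a b ≢ cornerColour a b p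
third-≢-cornerColour = toWitness {a? = all? λ a → all? λ b → ¬? (a ≟ b) →-dec all? λ p → ¬? (p ≟ 0F) →-dec
  ¬? (third a b ≟ cornerColour a b p)} _

factorSet-normal : ∀ c r r′ → r ≢ c → r′ ≢ c → NormalPair (factorSet c r) (factorSet c r′)
factorSet-normal = toWitness {a? = all? λ c → all? λ r → all? λ r′ → ¬? (r ≟ c) →-dec ¬? (r′ ≟ c) →-dec
  normalPair? (factorSet c r) (factorSet c r′)} _

aroundColour-own : ∀ a b p → aroundColour a b p p ≡ pendantColour a b p
aroundColour-own a b p rewrite dec-true (p ≟ p) refl = refl

aroundColour-side : ∀ a b {p j} → j ≢ p → aroundColour a b p j ≡ sideColour a b (third p j)
aroundColour-side a b {p} {j} j≢p rewrite dec-false (j ≟ p) j≢p = refl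

lookup-injective : ∀ {A : Set} {xs : List A} → Unique xs → ∀ i j → lookup xs i ≡ lookup xs j → i ≡ j
lookup-injective (_ ∷ _) zero zero _ = refl
lookup-injective (x≢xs ∷ _) zero (suc j) eq = ⊥-elim (All.lookup x≢xs (∈-lookup j) eq)
lookup-injective (x≢xs ∷ _) (suc i) zero eq = ⊥-elim (All.lookup x≢xs (∈-lookup i) (sym eq))
lookup-injective (_ ∷ u) (suc i) (suc j) eq = cong suc (lookup-injective u i j eq)

length-concatMap-tabulate : ∀ {A B : Set} {k} (f : A → List B) (g : Fin k → A) →
  length (concatMap f (List.tabulate g)) ≡ sumFin (λ i → length (f (g i)))
length-concatMap-tabulate {k = zero} f g = refl
length-concatMap-tabulate {k = suc k} f g =
  trans (length-++ (f (g zero))) (cong (length (f (g zero)) +_) (length-concatMap-tabulate f (g ∘ suc)))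

module _ {A : Set} where

  private
    head-∉ : ∀ {x : A} {xs} → Unique (x ∷ xs) → x ∉ xs
    head-∉ (x≢xs ∷ _) x∈xs = All.lookup x≢xs x∈xs refl

    ∈-map-pair⁻ : ∀ {x y z : A} {zs} → (x , y) ∈ map (z ,_) zs → x ≡ z × y ∈ zs
    ∈-map-pair⁻ p with ∈-map⁻ (_ ,_) p
    ... | w , w∈zs , eq = ,-injectiveˡ eq , subst (_∈ _) (sym (,-injectiveʳ eq)) w∈zs

  ∈-pairs⁻ : ∀ {x y : A} {xs} → (x , y) ∈ pairs xs → x ∈ xs × y ∈ xs
  ∈-pairs⁻ {xs = z ∷ zs} p with ∈-++⁻ (map (z ,_) zs) p
  ... | inj₁ q = let x≡z , y∈zs = ∈-map-pair⁻ q in here x≡z , there y∈zs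
  ... | inj₂ q = let x∈zs , y∈zs = ∈-pairs⁻ q in there x∈zs , there y∈zs

  ∈-pairs⁺ : ∀ {x y : A} {xs} → x ∈ xs → y ∈ xs → x ≢ y → (x , y) ∈ pairs xs ⊎ (y , x) ∈ pairs xs
  ∈-pairs⁺ (here refl) (here refl) x≢y = ⊥-elim (x≢y refl)
  ∈-pairs⁺ (here refl) (there y∈zs) _ = inj₁ (∈-++⁺ˡ (∈-map⁺ _ y∈zs))
  ∈-pairs⁺ (there x∈zs) (here refl) _ = inj₂ (∈-++⁺ˡ (∈-map⁺ _ x∈zs))
  ∈-pairs⁺ {xs = z ∷ zs} (there x∈zs) (there y∈zs) x≢y
    with ∈-pairs⁺ x∈zs y∈zs x≢y
  ... | inj₁ p = inj₁ (∈-++⁺ʳ (map (z ,_) zs) p)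
  ... | inj₂ p = inj₂ (∈-++⁺ʳ (map (z ,_) zs) p)

  pairs-≢ : ∀ {x y : A} {xs} → Unique xs → (x , y) ∈ pairs xs → x ≢ y
  pairs-≢ {xs = z ∷ zs} u@(_ ∷ uzs) p with ∈-++⁻ (map (z ,_) zs) p
  ... | inj₁ q = let x≡z , y∈zs = ∈-map-pair⁻ q in
    λ x≡y → head-∉ u (subst (_∈ zs) (trans (sym x≡y) x≡z) y∈zs)
  ... | inj₂ q = pairs-≢ uzs q

  pairs-asym : ∀ {x y : A} {xs} → Unique xs → (x , y) ∈ pairs xs → (y , x) ∉ pairs xs
  pairs-asym {xs = z ∷ zs} u@(_ ∷ uzs) p p′ with ∈-++⁻ (map (z ,_) zs) p | ∈-++⁻ (map (z ,_) zs) p′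
  ... | inj₁ q | inj₁ q′ = head-∉ u (subst (_∈ zs) (proj₁ (∈-map-pair⁻ q′)) (proj₂ (∈-map-pair⁻ q)))
  ... | inj₁ q | inj₂ q′ = head-∉ u (subst (_∈ zs) (proj₁ (∈-map-pair⁻ q)) (proj₂ (∈-pairs⁻ q′)))
  ... | inj₂ q | inj₁ q′ = head-∉ u (subst (_∈ zs) (proj₁ (∈-map-pair⁻ q′)) (proj₂ (∈-pairs⁻ q)))
  ... | inj₂ q | inj₂ q′ = pairs-asym uzs q q′

  pairs-unique : ∀ {xs : List A} → Unique xs → Unique (pairs xs)
  pairs-unique [] = []
  pairs-unique {z ∷ zs} u@(_ ∷ uzs) = Unique.++⁺
    (Unique.map⁺ ,-injectiveʳ uzs)
    (pairs-unique uzs)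
    λ (p , p′) → head-∉ u (subst (_∈ zs) (proj₁ (∈-map-pair⁻ p)) (proj₁ (∈-pairs⁻ p′)))

record Enumeration₃ {A : Set} (xs : List A) : Set where
  field
    element : F3 → A
    element-injective : ∀ {i j} → element i ≡ element j → i ≡ j
    element-∈ : ∀ i → element i ∈ xs
    ∈⇒element : ∀ {y} → y ∈ xs → ∃ λ i → element i ≡ y

module _ {A : Set} where

  enumeration₃ : ∀ {xs : List A} → Unique xs → length xs ≡ 3 → Enumeration₃ xs
  enumeration₃ {a ∷ b ∷ c ∷ []} ((a≢b ∷ a≢c ∷ _) ∷ (b≢c ∷ _) ∷ _) refl = record
    { element = element
    ; element-injective = injective _ _
    ; element-∈ = λ { 0F → here refl ; 1F → there (here refl) ; 2F → there (there (here refl)) }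
    ; ∈⇒element = λ { (here refl) → 0F , refl ; (there (here refl)) → 1F , refl
                    ; (there (there (here refl))) → 2F , refl } }
    where
    element : F3 → A
    element 0F = a
    element 1F = b
    element 2F = c
    injective : ∀ i j → element i ≡ element j → i ≡ j
    injective 0F 0F _ = refl
    injective 1F 1F _ = refl
    injective 2F 2F _ = refl
    injective 0F 1F eq = ⊥-elim (a≢b eq)
    injective 0F 2F eq = ⊥-elim (a≢c eq)
    injective 1F 2F eq = ⊥-elim (b≢c eq)
    injective 1F 0F eq = ⊥-elim (a≢b (sym eq))
    injective 2F 0F eq = ⊥-elim (a≢c (sym eq))
    injective 2F 1F eq = ⊥-elim (b≢c (sym eq))

  startingAt : ∀ {xs : List A} (E : Enumeration₃ xs) (i : F3) →
    Σ (Enumeration₃ xs) λ E′ → Enumeration₃.element E′ 0F ≡ Enumeration₃.element E i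
  startingAt E i = record
    { element = element ∘ (π ⟨$⟩ʳ_)
    ; element-injective = λ eq → trans (sym (inverseˡ π)) (trans (cong (π ⟨$⟩ˡ_) (element-injective eq)) (inverseˡ π))
    ; element-∈ = λ j → element-∈ (π ⟨$⟩ʳ j)
    ; ∈⇒element = λ y∈xs → let j , eq = ∈⇒element y∈xs in π ⟨$⟩ˡ j , trans (cong element (inverseʳ π)) eq }
    , refl
    where
    open Enumeration₃ E
    π = transpose 0F i

-- Half-edges

module HalfEdges (H : Multigraph) where

  private
    m : ℕ
    m = length (edges H)

  HalfEdge : Set
  HalfEdge = Fin (m * 2)

  halfEdge : Edge H → Fin 2 → HalfEdge
  halfEdge = combine

  edgeOf : HalfEdge → Edge H
  edgeOf z = proj₁ (remQuot {m} 2 z)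

  sideOf : HalfEdge → Fin 2
  sideOf z = proj₂ (remQuot {m} 2 z)

  halfEdge-edgeOf-sideOf : ∀ z → halfEdge (edgeOf z) (sideOf z) ≡ z
  halfEdge-edgeOf-sideOf = combine-remQuot {m} 2

  edgeOf-halfEdge : ∀ e s → edgeOf (halfEdge e s) ≡ e
  edgeOf-halfEdge e s = cong proj₁ (remQuot-combine e s)

  sideOf-halfEdge : ∀ e s → sideOf (halfEdge e s) ≡ s
  sideOf-halfEdge e s = cong proj₂ (remQuot-combine e s)

  endAt : Edge H → Fin 2 → Vertex H
  endAt e zero = end₁ H e
  endAt e (suc _) = end₂ H e

  vertexOf : HalfEdge → Vertex H
  vertexOf z = endAt (edgeOf z) (sideOf z)

  vertexOf-halfEdge : ∀ e s → vertexOf (halfEdge e s) ≡ endAt e s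
  vertexOf-halfEdge e s = cong₂ endAt (edgeOf-halfEdge e s) (sideOf-halfEdge e s)

  incident-edgeOf : ∀ z → Incident H (edgeOf z) (vertexOf z)
  incident-edgeOf z with sideOf z
  ... | zero = inj₁ refl
  ... | suc zero = inj₂ refl

  halfEdgesOn : Vertex H → Edge H → List HalfEdge
  halfEdgesOn v e = concatMap (λ s → if ⌊ endAt e s ≟ v ⌋ then halfEdge e s ∷ [] else []) (allFin 2)

  halfEdgesAt : Vertex H → List HalfEdge
  halfEdgesAt v = concatMap (halfEdgesOn v) (allFin m)

  length-halfEdgesAt : ∀ v → length (halfEdgesAt v) ≡ degree H v
  length-halfEdgesAt v = trans (length-concatMap-tabulate (halfEdgesOn v) (λ e → e)) (sumFin-cong length-halfEdgesOn)
    where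
    length-halfEdgesOn : ∀ e → length (halfEdgesOn v e) ≡ δ ⌊ end₁ H e ≟ v ⌋ + δ ⌊ end₂ H e ≟ v ⌋
    length-halfEdgesOn e with end₁ H e ≟ v | end₂ H e ≟ v
    ... | yes _ | yes _ = refl
    ... | yes _ | no _ = refl
    ... | no _ | yes _ = refl
    ... | no _ | no _ = refl
    sumFin-cong : ∀ {k} {f g : Fin k → ℕ} → (∀ i → f i ≡ g i) → sumFin f ≡ sumFin g
    sumFin-cong {zero} _ = refl
    sumFin-cong {suc k} f≗g = cong₂ _+_ (f≗g zero) (sumFin-cong (f≗g ∘ suc))

  ∈-halfEdgesOn⁻ : ∀ {v e z} → z ∈ halfEdgesOn v e → ∃ λ s → z ≡ halfEdge e s × endAt e s ≡ v
  ∈-halfEdgesOn⁻ {v} {e} z∈ with end₁ H e ≟ v | end₂ H e ≟ v | z∈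
  ... | yes p | _ | here refl = zero , refl , p
  ... | yes _ | yes q | there (here refl) = suc zero , refl , q
  ... | no _ | yes q | here refl = suc zero , refl , q
  ... | yes _ | no _ | there ()
  ... | no _ | yes _ | there ()
  ... | no _ | no _ | ()

  ∈-halfEdgesOn⁺ : ∀ {v} e s → endAt e s ≡ v → halfEdge e s ∈ halfEdgesOn v e
  ∈-halfEdgesOn⁺ {v} e s eq with end₁ H e ≟ v | end₂ H e ≟ v | s
  ... | yes _ | _ | zero = here refl
  ... | no p | _ | zero = ⊥-elim (p eq)
  ... | yes _ | yes _ | suc zero = there (here refl)
  ... | no _ | yes _ | suc zero = here refl
  ... | _ | no q | suc zero = ⊥-elim (q eq)

  ∈-halfEdgesAt⁻ : ∀ {v z} → z ∈ halfEdgesAt v → vertexOf z ≡ v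
  ∈-halfEdgesAt⁻ z∈ with satisfied (∈-concatMap⁻ _ {xs = allFin m} z∈)
  ... | e , z∈e with ∈-halfEdgesOn⁻ z∈e
  ... | s , refl , endAt≡v = trans (vertexOf-halfEdge e s) endAt≡v

  ∈-halfEdgesAt⁺ : ∀ {v} z → vertexOf z ≡ v → z ∈ halfEdgesAt v
  ∈-halfEdgesAt⁺ {v} z eq = subst (_∈ halfEdgesAt v) (halfEdge-edgeOf-sideOf z)
    (∈-concatMap⁺ (halfEdgesOn v) (tabulate⁺ (edgeOf z) (∈-halfEdgesOn⁺ (edgeOf z) (sideOf z) eq)))

  halfEdgesAt-unique : ∀ v → Unique (halfEdgesAt v)
  halfEdgesAt-unique v = Unique.concat⁺
    (All.map⁺ (All.tabulate⁺ halfEdgesOn-unique))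
    (AllPairs.map⁺ (AllPairs.map halfEdgesOn-disjoint (Unique.allFin⁺ m)))
    where
    halfEdgesOn-unique : ∀ e → Unique (halfEdgesOn v e)
    halfEdgesOn-unique e with end₁ H e ≟ v | end₂ H e ≟ v
    ... | yes _ | yes _ = ((λ eq → case proj₂ (combine-injective e zero e (suc zero) eq) of λ ()) ∷ []) ∷ [] ∷ []
    ... | yes _ | no _ = [] ∷ []
    ... | no _ | yes _ = [] ∷ []
    ... | no _ | no _ = []
    halfEdgesOn-disjoint : ∀ {e e′} → e ≢ e′ → Disjoint (halfEdgesOn v e) (halfEdgesOn v e′)
    halfEdgesOn-disjoint e≢e′ (z∈e , z∈e′) with ∈-halfEdgesOn⁻ z∈e | ∈-halfEdgesOn⁻ z∈e′
    ... | s , refl , _ | s′ , eq , _ = e≢e′ (proj₁ (combine-injective _ s _ s′ eq))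

  halfEdgeOn : ∀ {e v} → Incident H e v → HalfEdge
  halfEdgeOn {e} (inj₁ _) = halfEdge e zero
  halfEdgeOn {e} (inj₂ _) = halfEdge e (suc zero)

  edgeOf-halfEdgeOn : ∀ {e v} (inc : Incident H e v) → edgeOf (halfEdgeOn inc) ≡ e
  edgeOf-halfEdgeOn (inj₁ _) = edgeOf-halfEdge _ zero
  edgeOf-halfEdgeOn (inj₂ _) = edgeOf-halfEdge _ (suc zero)

  vertexOf-halfEdgeOn : ∀ {e v} (inc : Incident H e v) → vertexOf (halfEdgeOn inc) ≡ v
  vertexOf-halfEdgeOn (inj₁ p) = trans (vertexOf-halfEdge _ zero) p
  vertexOf-halfEdgeOn (inj₂ p) = trans (vertexOf-halfEdge _ (suc zero)) p

  edgeOf-sideOf-injective : ∀ {x y} → edgeOf x ≡ edgeOf y → sideOf x ≡ sideOf y → x ≡ y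
  edgeOf-sideOf-injective {x} {y} ex≡ey sx≡sy =
    trans (sym (halfEdge-edgeOf-sideOf x)) (trans (cong₂ halfEdge ex≡ey sx≡sy) (halfEdge-edgeOf-sideOf y))

  otherHalf-unique : ∀ {z w w′} → edgeOf w ≡ edgeOf z → w ≢ z → edgeOf w′ ≡ edgeOf z → w′ ≢ z → w ≡ w′
  otherHalf-unique ew w≢z ew′ w′≢z = edgeOf-sideOf-injective (trans ew (sym ew′))
    (other-side (w≢z ∘ edgeOf-sideOf-injective ew) (w′≢z ∘ edgeOf-sideOf-injective ew′))
    where
    other-side : ∀ {s s′ t : Fin 2} → s ≢ t → s′ ≢ t → s ≡ s′
    other-side {zero} {zero} _ _ = refl
    other-side {suc zero} {suc zero} _ _ = refl
    other-side {zero} {suc zero} {zero} s≢t _ = ⊥-elim (s≢t refl)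
    other-side {zero} {suc zero} {suc zero} _ s′≢t = ⊥-elim (s′≢t refl)
    other-side {suc zero} {zero} {zero} _ s′≢t = ⊥-elim (s′≢t refl)
    other-side {suc zero} {zero} {suc zero} s≢t _ = ⊥-elim (s≢t refl)

-- The edges of the triangle-replaced graph

module TriangleReplacement (H : Multigraph) (loopless : Loopless H) where
  open HalfEdges H

  HΔ : Multigraph
  HΔ = triangleReplace H

  private
    m = length (edges H)

    originalPairs : List (HalfEdge × HalfEdge)
    originalPairs = map (λ e → halfEdge e 0F , halfEdge e 1F) (allFin m)

    trianglePairs : List (HalfEdge × HalfEdge)
    trianglePairs = concatMap (λ v → pairs (halfEdgesAt v)) (allFin (n H))

    ∈-originalPairs⁻ : ∀ {x y} → (x , y) ∈ originalPairs → ∃ λ e → x ≡ halfEdge e 0F × y ≡ halfEdge e 1F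
    ∈-originalPairs⁻ p with ∈-map⁻ _ p
    ... | e , _ , eq = e , ,-injectiveˡ eq , ,-injectiveʳ eq

    ∈-trianglePairs⁻ : ∀ {x y} → (x , y) ∈ trianglePairs → vertexOf x ≡ vertexOf y × (x , y) ∈ pairs (halfEdgesAt (vertexOf x))
    ∈-trianglePairs⁻ p with satisfied (∈-concatMap⁻ _ {xs = allFin (n H)} p)
    ... | v , q with ∈-pairs⁻ q
    ... | x∈ , y∈ rewrite ∈-halfEdgesAt⁻ x∈ = sym (∈-halfEdgesAt⁻ y∈) , q

  halves-vertexOf-≢ : ∀ e → vertexOf (halfEdge e 0F) ≢ vertexOf (halfEdge e 1F)
  halves-vertexOf-≢ e eq = loopless e (trans (sym (vertexOf-halfEdge e 0F)) (trans eq (vertexOf-halfEdge e 1F)))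

  halves-≢ : ∀ e → halfEdge e 0F ≢ halfEdge e 1F
  halves-≢ e eq = halves-vertexOf-≢ e (cong vertexOf eq)

  sameVertex⇒edgeOf-≢ : ∀ {x y} → vertexOf x ≡ vertexOf y → x ≢ y → edgeOf x ≢ edgeOf y
  sameVertex⇒edgeOf-≢ {x} {y} vx≡vy x≢y ex≡ey with sideOf x ≟ sideOf y
  ... | yes sx≡sy = x≢y (edgeOf-sideOf-injective ex≡ey sx≡sy)
  ... | no sx≢sy = ends-≢ sx≢sy (trans (cong (λ e → endAt e (sideOf x)) (sym ex≡ey)) vx≡vy)
    where
    ends-≢ : ∀ {s s′} → s ≢ s′ → endAt (edgeOf y) s ≢ endAt (edgeOf y) s′
    ends-≢ {zero} {zero} s≢s′ _ = s≢s′ refl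
    ends-≢ {zero} {suc zero} _ = loopless (edgeOf y)
    ends-≢ {suc zero} {zero} _ eq = loopless (edgeOf y) (sym eq)
    ends-≢ {suc zero} {suc zero} s≢s′ _ = s≢s′ refl

  data Shape (x y : HalfEdge) : Set where
    original : edgeOf x ≡ edgeOf y → x ≢ y → Shape x y
    triangle : vertexOf x ≡ vertexOf y → x ≢ y → Shape x y

  ∈-edges⇒shape : ∀ {x y} → (x , y) ∈ edges HΔ → Shape x y
  ∈-edges⇒shape p with ∈-++⁻ originalPairs p
  ... | inj₁ q with ∈-originalPairs⁻ q
  ...   | e , refl , refl = original (trans (edgeOf-halfEdge e 0F) (sym (edgeOf-halfEdge e 1F))) (halves-≢ e)
  ∈-edges⇒shape p | inj₂ q = let vx≡vy , q′ = ∈-trianglePairs⁻ q in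
    triangle vx≡vy (pairs-≢ (halfEdgesAt-unique _) q′)

  private
    originalPairs-vertexOf-≢ : ∀ {x y} → (x , y) ∈ originalPairs → vertexOf x ≢ vertexOf y
    originalPairs-vertexOf-≢ q with ∈-originalPairs⁻ q
    ... | e , refl , refl = halves-vertexOf-≢ e

  edges-asym : ∀ {x y} → (x , y) ∈ edges HΔ → (y , x) ∉ edges HΔ
  edges-asym p p′ with ∈-++⁻ originalPairs p | ∈-++⁻ originalPairs p′
  ... | inj₁ q | inj₁ q′ with ∈-originalPairs⁻ q | ∈-originalPairs⁻ q′
  ...   | e , _ , refl | _ , eq , _ with () ← proj₂ (combine-injective e 1F _ 0F eq)
  edges-asym p p′ | inj₁ q | inj₂ q′ = originalPairs-vertexOf-≢ q (sym (proj₁ (∈-trianglePairs⁻ q′)))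
  edges-asym p p′ | inj₂ q | inj₁ q′ = originalPairs-vertexOf-≢ q′ (sym (proj₁ (∈-trianglePairs⁻ q)))
  edges-asym p p′ | inj₂ q | inj₂ q′ with ∈-trianglePairs⁻ q | ∈-trianglePairs⁻ q′
  ... | vx≡vy , r | _ , r′ rewrite vx≡vy = pairs-asym (halfEdgesAt-unique _) r r′

  edges-unique : Unique (edges HΔ)
  edges-unique = Unique.++⁺
    (Unique.map⁺ (λ eq → proj₁ (combine-injective _ 0F _ 0F (,-injectiveˡ eq))) (Unique.allFin⁺ m))
    (Unique.concat⁺
      (All.map⁺ (All.tabulate⁺ (λ v → pairs-unique (halfEdgesAt-unique v))))
      (AllPairs.map⁺ (AllPairs.map pairs-disjoint (Unique.allFin⁺ (n H)))))
    (λ (q , q′) → originalPairs-vertexOf-≢ q (proj₁ (∈-trianglePairs⁻ q′)))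
    where
    pairs-disjoint : ∀ {v w} → v ≢ w → ∀ {p} → ¬ (p ∈ pairs (halfEdgesAt v) × p ∈ pairs (halfEdgesAt w))
    pairs-disjoint v≢w (q , q′) =
      v≢w (trans (sym (∈-halfEdgesAt⁻ (proj₁ (∈-pairs⁻ q)))) (∈-halfEdgesAt⁻ (proj₁ (∈-pairs⁻ q′))))

  Joins : Edge HΔ → HalfEdge → HalfEdge → Set
  Joins i x y = (end₁ HΔ i ≡ x × end₂ HΔ i ≡ y) ⊎ (end₁ HΔ i ≡ y × end₂ HΔ i ≡ x)

  joins-sym : ∀ {i x y} → Joins i x y → Joins i y x
  joins-sym (inj₁ (p , q)) = inj₂ (p , q)
  joins-sym (inj₂ (p , q)) = inj₁ (p , q)

  shape : ∀ i → Shape (end₁ HΔ i) (end₂ HΔ i)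
  shape i = ∈-edges⇒shape (∈-lookup i)

  private
    ∈-edges⇒joins : ∀ {x y} → (x , y) ∈ edges HΔ → ∃ λ i → Joins i x y
    ∈-edges⇒joins p = Any.index p , inj₁ (,-injectiveˡ eq , ,-injectiveʳ eq)
      where eq = sym (lookup-index p)

    ends-∈ : ∀ i {x y} → end₁ HΔ i ≡ x → end₂ HΔ i ≡ y → (x , y) ∈ edges HΔ
    ends-∈ i refl refl = ∈-lookup i

    ∈-pairs⇒∈-edges : ∀ {v x y} → (x , y) ∈ pairs (halfEdgesAt v) → (x , y) ∈ edges HΔ
    ∈-pairs⇒∈-edges {v} p = ∈-++⁺ʳ originalPairs (∈-concatMap⁺ _ (tabulate⁺ v p))

  joins-original : ∀ e → ∃ λ i → Joins i (halfEdge e 0F) (halfEdge e 1F)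
  joins-original e = ∈-edges⇒joins (∈-++⁺ˡ (∈-map⁺ _ (∈-allFin e)))

  joins-triangle : ∀ {x y} → vertexOf x ≡ vertexOf y → x ≢ y → ∃ λ i → Joins i x y
  joins-triangle {x} {y} vx≡vy x≢y
    with ∈-pairs⁺ (∈-halfEdgesAt⁺ x refl) (∈-halfEdgesAt⁺ y (sym vx≡vy)) x≢y
  ... | inj₁ p = ∈-edges⇒joins (∈-pairs⇒∈-edges p)
  ... | inj₂ p = let i , j = ∈-edges⇒joins (∈-pairs⇒∈-edges p) in i , joins-sym j

  joins-unique : ∀ {i j x y} → Joins i x y → Joins j x y → i ≡ j
  joins-unique {i} {j} (inj₁ (p , q)) (inj₁ (p′ , q′)) =
    lookup-injective edges-unique i j (cong₂ _,_ (trans p (sym p′)) (trans q (sym q′)))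
  joins-unique {i} {j} (inj₂ (p , q)) (inj₂ (p′ , q′)) =
    lookup-injective edges-unique i j (cong₂ _,_ (trans p (sym p′)) (trans q (sym q′)))
  joins-unique {i} {j} (inj₁ (p , q)) (inj₂ (p′ , q′)) = ⊥-elim (edges-asym (ends-∈ i p q) (ends-∈ j p′ q′))
  joins-unique {i} {j} (inj₂ (p , q)) (inj₁ (p′ , q′)) = ⊥-elim (edges-asym (ends-∈ j p′ q′) (ends-∈ i p q))

  shape-sym : ∀ {x y} → Shape x y → Shape y x
  shape-sym (original p x≢y) = original (sym p) (x≢y ∘ sym)
  shape-sym (triangle p x≢y) = triangle (sym p) (x≢y ∘ sym)

  joins-shape : ∀ {i x y} → Joins i x y → Shape x y
  joins-shape {i} (inj₁ (refl , refl)) = shape i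
  joins-shape {i} (inj₂ (refl , refl)) = shape-sym (shape i)

  incident⇒joins : ∀ {i z} → Incident HΔ i z → ∃ λ w → Joins i z w
  incident⇒joins (inj₁ p) = _ , inj₁ (p , refl)
  incident⇒joins (inj₂ q) = _ , inj₂ (refl , q)

  joins⇒incident : ∀ {i z w} → Joins i z w → Incident HΔ i z
  joins⇒incident (inj₁ (p , _)) = inj₁ p
  joins⇒incident (inj₂ (_ , q)) = inj₂ q

  joins-otherHalf : ∀ e s → ∃₂ λ w i → edgeOf w ≡ e × w ≢ halfEdge e s × Joins i (halfEdge e s) w
  joins-otherHalf e zero = let i , J = joins-original e in
    halfEdge e 1F , i , edgeOf-halfEdge e 1F , halves-≢ e ∘ sym , J
  joins-otherHalf e (suc zero) = let i , J = joins-original e in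
    halfEdge e 0F , i , edgeOf-halfEdge e 0F , halves-≢ e , joins-sym J

-- The normal 6-edge-colouring

module NormalColouring (H : Multigraph) (cubic : Cubic H) (M : Edge H → Bool) (perfect : PerfectMatching H M) where
  open HalfEdges H
  open TriangleReplacement H (proj₁ cubic)

  matchingEdge : Vertex H → Edge H
  matchingEdge v = proj₁ (perfect v)

  matchingEdge-incident : ∀ v → Incident H (matchingEdge v) v
  matchingEdge-incident v = proj₁ (proj₂ (proj₂ (perfect v)))

  matchedHalfEdge : Vertex H → HalfEdge
  matchedHalfEdge v = halfEdgeOn (matchingEdge-incident v)

  private
    cornerEnumeration : ∀ v → Σ (Enumeration₃ (halfEdgesAt v)) λ E → Enumeration₃.element E 0F ≡ matchedHalfEdge v
    cornerEnumeration v =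
      let i , eᵢ≡m = ∈⇒element (∈-halfEdgesAt⁺ (matchedHalfEdge v) (vertexOf-halfEdgeOn (matchingEdge-incident v)))
          E′ , e′₀≡eᵢ = startingAt E i
      in E′ , trans e′₀≡eᵢ eᵢ≡m
      where
      E = enumeration₃ (halfEdgesAt-unique v) (trans (length-halfEdgesAt v) (proj₂ cubic v))
      open Enumeration₃ E using (∈⇒element)
    module Corners v = Enumeration₃ (proj₁ (cornerEnumeration v))

  -- Opaque because unification would otherwise unfold these through the enumeration, which is very slow.
  opaque
    corner : Vertex H → F3 → HalfEdge
    corner = Corners.element

    cornerOf : HalfEdge → F3
    cornerOf z = proj₁ (Corners.∈⇒element (vertexOf z) (∈-halfEdgesAt⁺ z refl))

    corner-injective : ∀ {v i j} → corner v i ≡ corner v j → i ≡ j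
    corner-injective {v} = Corners.element-injective v

    vertexOf-corner : ∀ v i → vertexOf (corner v i) ≡ v
    vertexOf-corner v i = ∈-halfEdgesAt⁻ (Corners.element-∈ v i)

    corner-cornerOf : ∀ z → corner (vertexOf z) (cornerOf z) ≡ z
    corner-cornerOf z = proj₂ (Corners.∈⇒element (vertexOf z) (∈-halfEdgesAt⁺ z refl))

    corner-0F : ∀ v → corner v 0F ≡ matchedHalfEdge v
    corner-0F v = proj₂ (cornerEnumeration v)

  cornerOf-unique : ∀ {z v i} → vertexOf z ≡ v → corner v i ≡ z → cornerOf z ≡ i
  cornerOf-unique {z} refl eq = corner-injective (trans (corner-cornerOf z) (sym eq))

  cornerOf-corner : ∀ v i → cornerOf (corner v i) ≡ i
  cornerOf-corner v i = cornerOf-unique (vertexOf-corner v i) refl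

  edgeOf-corner-≢ : ∀ v {i j} → i ≢ j → edgeOf (corner v i) ≢ edgeOf (corner v j)
  edgeOf-corner-≢ v {i} {j} i≢j = sameVertex⇒edgeOf-≢
    (trans (vertexOf-corner v i) (sym (vertexOf-corner v j))) (i≢j ∘ corner-injective)

  edgeOf-corner-0F : ∀ v → edgeOf (corner v 0F) ≡ matchingEdge v
  edgeOf-corner-0F v = trans (cong edgeOf (corner-0F v)) (edgeOf-halfEdgeOn (matchingEdge-incident v))

  matched⇒cornerOf≡0 : ∀ z → M (edgeOf z) ≡ true → cornerOf z ≡ 0F
  matched⇒cornerOf≡0 z Mz with z ≟ corner (vertexOf z) 0F
  ... | yes z≡c₀ = cornerOf-unique refl (sym z≡c₀)
  ... | no z≢c₀ = ⊥-elim (sameVertex⇒edgeOf-≢ (sym (vertexOf-corner v 0F)) z≢c₀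
                          (trans (unique (edgeOf z) Mz (incident-edgeOf z)) (sym (edgeOf-corner-0F v))))
    where
    v = vertexOf z
    unique = proj₂ (proj₂ (proj₂ (perfect v)))

  matched-corner : ∀ v → M (edgeOf (corner v 0F)) ≡ true
  matched-corner v = trans (cong M (edgeOf-corner-0F v)) (proj₁ (proj₂ (perfect v)))

  unmatched⇒cornerOf≢0 : ∀ z → M (edgeOf z) ≡ false → cornerOf z ≢ 0F
  unmatched⇒cornerOf≢0 z Mz cz≡0 with () ← trans (sym Mz)
    (trans (cong (M ∘ edgeOf) (sym (corner-cornerOf z)))
           (trans (cong (λ i → M (edgeOf (corner (vertexOf z) i))) cz≡0) (matched-corner (vertexOf z))))

  unmatched-corner : ∀ v {i} → i ≢ 0F → M (edgeOf (corner v i)) ≡ false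
  unmatched-corner v {i} i≢0 with M (edgeOf (corner v i)) in Mc
  ... | false = refl
  ... | true = ⊥-elim (i≢0 (trans (sym (cornerOf-corner v i)) (matched⇒cornerOf≡0 (corner v i) Mc)))

  private
    -- The other half-edge at the same vertex on the 2-factor: third 0F swaps the corners 1F and 2F.
    nextOnCycle : HalfEdge → HalfEdge
    nextOnCycle z = corner (vertexOf z) (third 0F (cornerOf z))

    cycleNeighbour : Edge H → Fin 2 → Edge H
    cycleNeighbour e s = edgeOf (nextOnCycle (halfEdge e s))

    cycleNeighbour-corner : ∀ v i → cycleNeighbour (edgeOf (corner v i)) (sideOf (corner v i)) ≡ edgeOf (corner v (third 0F i))
    cycleNeighbour-corner v i = trans (cong (edgeOf ∘ nextOnCycle) (halfEdge-edgeOf-sideOf (corner v i)))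
      (cong edgeOf (cong₂ (λ w j → corner w (third 0F j)) (vertexOf-corner v i) (cornerOf-corner v i)))

  -- Only its values on 2-factor edges matter.
  open GreedyColouring cycleNeighbour using () renaming (colour to factorColouring; colour-proper to factorColouring-proper)

  factorColouringAt : Vertex H → F3 → F3
  factorColouringAt v i = factorColouring (edgeOf (corner v i))

  factorColouringAt-≢ : ∀ v → factorColouringAt v 1F ≢ factorColouringAt v 2F
  factorColouringAt-≢ v eq =
    factorColouring-proper e₁ s₁ s₂ next≢e₁ next-back (trans eq (cong factorColouring (sym next≡e₂)))
    where
    e₁ = edgeOf (corner v 1F)
    s₁ = sideOf (corner v 1F)
    s₂ = sideOf (corner v 2F)
    next≡e₂ : cycleNeighbour e₁ s₁ ≡ edgeOf (corner v 2F)
    next≡e₂ = cycleNeighbour-corner v 1F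
    next≢e₁ : cycleNeighbour e₁ s₁ ≢ e₁
    next≢e₁ p = edgeOf-corner-≢ v {2F} {1F} (λ ()) (trans (sym next≡e₂) p)
    next-back : cycleNeighbour (cycleNeighbour e₁ s₁) s₂ ≡ e₁
    next-back = trans (cong (λ e → cycleNeighbour e s₂) next≡e₂) (cycleNeighbour-corner v 2F)

  originalColour : Edge H → Fin 6
  originalColour e = if M e then matchColour else factorColour (factorColouring e)

  sideColourAt : Vertex H → F3 → Fin 6
  sideColourAt v = sideColour (factorColouringAt v 1F) (factorColouringAt v 2F)

  aroundColourAt : Vertex H → F3 → F3 → Fin 6
  aroundColourAt v = aroundColour (factorColouringAt v 1F) (factorColouringAt v 2F)

  aroundSetAt : Vertex H → F3 → Subset 6
  aroundSetAt v = aroundSet (factorColouringAt v 1F) (factorColouringAt v 2F)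

  pairColour : HalfEdge → HalfEdge → Fin 6
  pairColour x y = if does (vertexOf x ≟ vertexOf y)
    then sideColourAt (vertexOf x) (third (cornerOf x) (cornerOf y))
    else originalColour (edgeOf x)

  colouring : EdgeColoring HΔ 6
  colouring i = pairColour (end₁ HΔ i) (end₂ HΔ i)

  pairColour-original : ∀ {x y} → edgeOf x ≡ edgeOf y → x ≢ y → pairColour x y ≡ originalColour (edgeOf x)
  pairColour-original {x} {y} ex≡ey x≢y
    rewrite dec-false (vertexOf x ≟ vertexOf y) (λ vx≡vy → sameVertex⇒edgeOf-≢ vx≡vy x≢y ex≡ey) = refl

  pairColour-triangle : ∀ {x y} → vertexOf x ≡ vertexOf y →
    pairColour x y ≡ sideColourAt (vertexOf x) (third (cornerOf x) (cornerOf y))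
  pairColour-triangle {x} {y} vx≡vy rewrite dec-true (vertexOf x ≟ vertexOf y) vx≡vy = refl

  pairColour-sym : ∀ {x y} → Shape x y → pairColour x y ≡ pairColour y x
  pairColour-sym (original ex≡ey x≢y) = trans (pairColour-original ex≡ey x≢y)
    (trans (cong originalColour ex≡ey) (sym (pairColour-original (sym ex≡ey) (x≢y ∘ sym))))
  pairColour-sym {x} {y} (triangle vx≡vy _) = trans (pairColour-triangle vx≡vy)
    (trans (cong₂ sideColourAt vx≡vy (third-comm (cornerOf x) (cornerOf y))) (sym (pairColour-triangle (sym vx≡vy))))

  colouring-joins : ∀ {i x y} → Joins i x y → colouring i ≡ pairColour x y
  colouring-joins (inj₁ (refl , refl)) = refl
  colouring-joins {i} (inj₂ (refl , refl)) = pairColour-sym (shape i)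

  originalColour-matched : ∀ {e} → M e ≡ true → originalColour e ≡ matchColour
  originalColour-matched {e} Me = cong (λ b → if b then matchColour else factorColour (factorColouring e)) Me

  originalColour-unmatched : ∀ {e} → M e ≡ false → originalColour e ≡ factorColour (factorColouring e)
  originalColour-unmatched {e} Me = cong (λ b → if b then matchColour else factorColour (factorColouring e)) Me

  pendantColour-corner : ∀ v i → pendantColour (factorColouringAt v 1F) (factorColouringAt v 2F) i ≡ originalColour (edgeOf (corner v i))
  pendantColour-corner v 0F = sym (originalColour-matched (matched-corner v))
  pendantColour-corner v 1F = sym (originalColour-unmatched (unmatched-corner v {1F} (λ ())))
  pendantColour-corner v 2F = sym (originalColour-unmatched (unmatched-corner v {2F} (λ ())))

  aroundColourAt-own : ∀ z → aroundColourAt (vertexOf z) (cornerOf z) (cornerOf z) ≡ originalColour (edgeOf z)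
  aroundColourAt-own z = trans (aroundColour-own _ _ (cornerOf z))
    (trans (pendantColour-corner (vertexOf z) (cornerOf z)) (cong (originalColour ∘ edgeOf) (corner-cornerOf z)))

  data Towards (z : HalfEdge) : F3 → HalfEdge → Set where
    along  : ∀ {w} → edgeOf w ≡ edgeOf z → w ≢ z → Towards z (cornerOf z) w
    across : ∀ {j} → j ≢ cornerOf z → Towards z j (corner (vertexOf z) j)

  towards-functional : ∀ {z j w w′} → Towards z j w → Towards z j w′ → w ≡ w′
  towards-functional (along ew w≢z) (along ew′ w′≢z) = otherHalf-unique ew w≢z ew′ w′≢z
  towards-functional (along _ _) (across j≢j) = ⊥-elim (j≢j refl)
  towards-functional (across j≢j) (along _ _) = ⊥-elim (j≢j refl)
  towards-functional (across _) (across _) = refl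

  private
    towards-index : ∀ {z j w} → Towards z j w →
      (vertexOf w ≢ vertexOf z × j ≡ cornerOf z) ⊎ (vertexOf w ≡ vertexOf z × j ≡ cornerOf w)
    towards-index (along ew w≢z) = inj₁ ((λ vw≡vz → sameVertex⇒edgeOf-≢ vw≡vz w≢z ew) , refl)
    towards-index {z} (across {j} _) = inj₂ (vertexOf-corner (vertexOf z) j , sym (cornerOf-corner (vertexOf z) j))

  towards-injective : ∀ {z j j′ w} → Towards z j w → Towards z j′ w → j ≡ j′
  towards-injective T T′ with towards-index T | towards-index T′
  ... | inj₁ (_ , p) | inj₁ (_ , p′) = trans p (sym p′)
  ... | inj₂ (_ , p) | inj₂ (_ , p′) = trans p (sym p′)
  ... | inj₁ (v≢ , _) | inj₂ (v≡ , _) = ⊥-elim (v≢ v≡)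
  ... | inj₂ (v≡ , _) | inj₁ (v≢ , _) = ⊥-elim (v≢ v≡)

  joins⇒towards : ∀ {i z w} → Joins i z w → ∃ λ j → Towards z j w × colouring i ≡ aroundColourAt (vertexOf z) (cornerOf z) j
  joins⇒towards {i} {z} {w} J with joins-shape J
  ... | original ez≡ew z≢w = cornerOf z , along (sym ez≡ew) (z≢w ∘ sym) ,
    trans (colouring-joins J) (trans (pairColour-original ez≡ew z≢w) (sym (aroundColourAt-own z)))
  ... | triangle vz≡vw z≢w = cornerOf w , subst (Towards z (cornerOf w)) w≡corner (across cw≢cz) ,
    trans (colouring-joins J) (trans (pairColour-triangle vz≡vw) (sym (aroundColour-side _ _ cw≢cz)))
    where
    w≡corner : corner (vertexOf z) (cornerOf w) ≡ w
    w≡corner = trans (cong (λ u → corner u (cornerOf w)) vz≡vw) (corner-cornerOf w)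
    cw≢cz : cornerOf w ≢ cornerOf z
    cw≢cz cw≡cz = z≢w (trans (sym (corner-cornerOf z)) (trans (cong (corner (vertexOf z)) (sym cw≡cz)) w≡corner))

  towards⇒joins : ∀ z j → ∃₂ λ w i → Towards z j w × Joins i z w
  towards⇒joins z j with j ≟ cornerOf z
  ... | yes refl = let w , i , ew , w≢hz , J = joins-otherHalf (edgeOf z) (sideOf z) in
    w , i , along ew (λ w≡z → w≢hz (trans w≡z (sym hz))) , subst (λ x → Joins i x w) hz J
    where hz = halfEdge-edgeOf-sideOf z
  ... | no j≢cz = corner (vertexOf z) j , proj₁ edge , across j≢cz , proj₂ edge
    where edge = joins-triangle (sym (vertexOf-corner (vertexOf z) j)) (λ z≡c → j≢cz (sym (cornerOf-unique refl (sym z≡c))))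

  S-colouring : ∀ z → S HΔ colouring z ≡ aroundSetAt (vertexOf z) (cornerOf z)
  S-colouring z = tabulate-cong λ k → isYes-⇔ (to k) (from k)
    (any? (λ i → incident? HΔ i z ×-dec (colouring i ≟ k))) (any? (λ j → colour-at j ≟ k))
    where
    colour-at = aroundColourAt (vertexOf z) (cornerOf z)
    to : ∀ k → (∃ λ i → Incident HΔ i z × colouring i ≡ k) → ∃ λ j → colour-at j ≡ k
    to k (i , inc , ci≡k) =
      let (w , J) = incident⇒joins inc ; (j , _ , ci≡) = joins⇒towards J in j , trans (sym ci≡) ci≡k
    from : ∀ k → (∃ λ j → colour-at j ≡ k) → ∃ λ i → Incident HΔ i z × colouring i ≡ k
    from k (j , cj≡k) =
      let (w , i , T , J) = towards⇒joins z j ; (j′ , T′ , ci≡) = joins⇒towards J in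
      i , joins⇒incident J , trans ci≡ (trans (cong colour-at (towards-injective T′ T)) cj≡k)

  colouring-proper : Proper HΔ colouring
  colouring-proper i i′ i≢i′ (z , inc , inc′) ci≡ci′ with incident⇒joins inc | incident⇒joins inc′
  ... | w , z~w | w′ , z~w′ with joins⇒towards z~w | joins⇒towards z~w′
  ... | j , T , ci≡ | j′ , T′ , ci′≡ = i≢i′ (joins-unique z~w (subst (Joins i′ z) (sym w≡w′) z~w′))
    where
    j≡j′ : j ≡ j′
    j≡j′ = aroundColour-injective _ _ (factorColouringAt-≢ (vertexOf z)) (cornerOf z) j j′
      (trans (sym ci≡) (trans ci≡ci′ ci′≡))
    w≡w′ : w ≡ w′
    w≡w′ = towards-functional T (subst (λ j → Towards z j w′) (sym j≡j′) T′)

  missingColourAt : Vertex H → F3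
  missingColourAt v = third (factorColouringAt v 1F) (factorColouringAt v 2F)

  private
    cornerColour-factorColouringAt : ∀ v {i} → i ≢ 0F → cornerColour (factorColouringAt v 1F) (factorColouringAt v 2F) i ≡ factorColouringAt v i
    cornerColour-factorColouringAt v {0F} i≢0 = ⊥-elim (i≢0 refl)
    cornerColour-factorColouringAt v {1F} _ = refl
    cornerColour-factorColouringAt v {2F} _ = refl

  aroundSetAt-matched : ∀ z → M (edgeOf z) ≡ true → aroundSetAt (vertexOf z) (cornerOf z) ≡ colourSet matchColour (# 4) (# 5)
  aroundSetAt-matched z Mz = trans (cong (aroundSetAt (vertexOf z)) (matched⇒cornerOf≡0 z Mz))
    (aroundSet-matched _ _ (factorColouringAt-≢ (vertexOf z)))

  aroundSetAt-unmatched : ∀ z → M (edgeOf z) ≡ false →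
    aroundSetAt (vertexOf z) (cornerOf z) ≡ factorSet (factorColouring (edgeOf z)) (missingColourAt (vertexOf z)) ×
    missingColourAt (vertexOf z) ≢ factorColouring (edgeOf z)
  aroundSetAt-unmatched z Mz =
    trans (aroundSet-factor _ _ valid p p≢0) (cong (λ c → factorSet c (missingColourAt v)) colour≡) ,
    subst (missingColourAt v ≢_) colour≡ (third-≢-cornerColour _ _ valid p p≢0)
    where
    v = vertexOf z
    p = cornerOf z
    valid = factorColouringAt-≢ v
    p≢0 = unmatched⇒cornerOf≢0 z Mz
    colour≡ : cornerColour (factorColouringAt v 1F) (factorColouringAt v 2F) p ≡ factorColouring (edgeOf z)
    colour≡ = trans (cornerColour-factorColouringAt v p≢0) (cong (factorColouring ∘ edgeOf) (corner-cornerOf z))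

  aroundSetAt-normal : ∀ {x y} → Shape x y → NormalPair (aroundSetAt (vertexOf x) (cornerOf x)) (aroundSetAt (vertexOf y) (cornerOf y))
  aroundSetAt-normal {x} {y} (triangle vx≡vy x≢y) =
    inj₂ (subst (λ B → ∣ aroundSetAt (vertexOf x) (cornerOf x) ∪ B ∣ ≡ 5) (cong (λ v → aroundSetAt v (cornerOf y)) vx≡vy)
           (aroundSet-side _ _ (factorColouringAt-≢ (vertexOf x)) (cornerOf x) (cornerOf y) cx≢cy))
    where
    cx≢cy : cornerOf x ≢ cornerOf y
    cx≢cy cx≡cy = x≢y (trans (sym (corner-cornerOf x))
      (trans (cong₂ corner vx≡vy cx≡cy) (corner-cornerOf y)))
  aroundSetAt-normal {x} {y} (original ex≡ey x≢y) = by-matching (M (edgeOf x)) refl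
    where
    by-matching : ∀ b → M (edgeOf x) ≡ b → NormalPair (aroundSetAt (vertexOf x) (cornerOf x)) (aroundSetAt (vertexOf y) (cornerOf y))
    by-matching true Mx = subst₂ NormalPair (sym (aroundSetAt-matched x Mx)) (sym (aroundSetAt-matched y My)) (inj₁ refl)
      where My = trans (cong M (sym ex≡ey)) Mx
    by-matching false Mx = subst₂ NormalPair (sym Sx) (sym (trans Sy (cong (λ e → factorSet (factorColouring e) _) (sym ex≡ey))))
        (factorSet-normal _ _ _ rx≢ (λ r≡ → ry≢ (trans r≡ (cong factorColouring ex≡ey))))
      where
      My = trans (cong M (sym ex≡ey)) Mx
      Sx = proj₁ (aroundSetAt-unmatched x Mx)
      rx≢ = proj₂ (aroundSetAt-unmatched x Mx)
      Sy = proj₁ (aroundSetAt-unmatched y My)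
      ry≢ = proj₂ (aroundSetAt-unmatched y My)

  colouring-normal : ∀ i → NormalEdge HΔ colouring i
  colouring-normal i = subst₂ NormalPair (sym (S-colouring (end₁ HΔ i))) (sym (S-colouring (end₂ HΔ i)))
    (aroundSetAt-normal (shape i))

lemma1 : (H : Defs.Multigraph) → Cubic H → HasPerfectMatching H → χ'N≤ (triangleReplace H) 6
lemma1 H cubic (M , perfect) = 6 , ≤-refl , colouring , colouring-proper , colouring-normal
  where open NormalColouring H cubic M perfect
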